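{- Let $G$ be a complete $l$-partite graph (for some $l\ge 1$) with $n$ vertices, $e$ edges and $t$ triangles, and let $P$ be any greedy partition of $G$, with size $r=r(P)$. Define $g(G,P)=r\,(e-r(n-r))-t$. Then $g(G,P)\le 0$. Moreover, if $G$ is a complete $3$-partite graph (where some parts may be empty), then $g(G,P)=0$.
   Context: A good partition $P$ of $V(G)$ is a partition of $V(G)$ into disjoint sets $C_0,C_1,\dots$ (the cliques of $P$), each inducing a complete subgraph of $G$, indexed so that $|C_0|\le |C_1|\le \cdots$. The size $r(P)$ of $P$ is the number of cliques in it. A good partition is a greedy partition if for every $i\ge 1$ the subgraph of $G$ induced by $C_0\cup\dots\cup C_i$ contains no complete subgraph on $|C_i|+1$ vertices. (For a complete multipartite graph every greedy partition has size equal to the size of the largest part.) $t$ denotes the number of triangles of $G$. -}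

module Defs where

open import Data.Nat using (ℕ; zero; suc; _+_; _*_; _≤_; _<ᵇ_)
open import Data.Bool using (Bool; true; false; if_then_else_; _∧_)
open import Data.Fin using (Fin; toℕ; _≟_)
import Data.Fin as F
open import Data.Integer as ℤ using (ℤ; +_)
open import Data.Product using (∃; Σ; _×_)
open import Relation.Nullary using (¬_; ⌊_⌋)
open import Relation.Binary.PropositionalEquality using (_≡_; _≢_)

sumFin : ∀ {n} → (Fin n → ℕ) → ℕ
sumFin {zero}  f = 0
sumFin {suc n} f = f F.zero + sumFin (λ i → f (F.suc i))

count : ∀ {n} → (Fin n → Bool) → ℕ
count f = sumFin (λ i → if f i then 1 else 0)

record Graph (n : ℕ) : Set where
  field
    Adj    : Fin n → Fin n → Bool
    sym    : ∀ u v → Adj u v ≡ Adj v u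
    irrefl : ∀ u → Adj u u ≡ false
open Graph public

_<ᶠ_ : ∀ {n} → Fin n → Fin n → Bool
u <ᶠ v = toℕ u <ᵇ toℕ v

edges : ∀ {n} → Graph n → ℕ
edges G = sumFin λ u → count λ v → (u <ᶠ v) ∧ Adj G u v

triangles : ∀ {n} → Graph n → ℕ
triangles G = sumFin λ u → sumFin λ v → count λ w →
  (u <ᶠ v) ∧ (v <ᶠ w) ∧ Adj G u v ∧ Adj G v w ∧ Adj G u w

IsCompleteMultipartite : ∀ {n} → Graph n → (l : ℕ) → (p : Fin n → Fin l) → Set
IsCompleteMultipartite G l p = ∀ u v → (Adj G u v ≡ true → p u ≢ p v) × (p u ≢ p v → Adj G u v ≡ true)

IsCliqueSet : ∀ {n} → Graph n → (Fin n → Bool) → Set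
IsCliqueSet G S = ∀ u v → S u ≡ true → S v ≡ true → u ≢ v → Adj G u v ≡ true

-- a greedy partition of V(G) into r cliques C_0, …, C_{r-1};
-- vertex v lies in clique C_(cls v)
record GreedyPartition {n : ℕ} (G : Graph n) (r : ℕ) : Set where
  field
    cls : Fin n → Fin r
  size : Fin r → ℕ
  size i = count λ v → ⌊ cls v ≟ i ⌋
  field
    nonempty : ∀ i → ∃ λ v → cls v ≡ i
    clique   : ∀ u v → cls u ≡ cls v → u ≢ v → Adj G u v ≡ true
    sorted   : ∀ i j → toℕ i ≤ toℕ j → size i ≤ size j
    greedy   : ∀ i → 1 ≤ toℕ i → ∀ (S : Fin n → Bool) →
               (∀ v → S v ≡ true → toℕ (cls v) ≤ toℕ i) →
               IsCliqueSet G S → count S ≢ suc (size i)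

gval : ∀ {n} → Graph n → ℕ → ℤ
gval {n} G r = + r ℤ.* (+ edges G ℤ.- + r ℤ.* (+ n ℤ.- + r)) ℤ.- + triangles G

module Submission where

-- Let G be complete multipartite with parts given by p, and let
-- P = (C_0, …, C_{r-1}) be a greedy partition (r ≥ 1 when G has vertices).
-- Fix a vertex v₀ ∈ C_0 and let A be its part.  A clique meets the
-- independent set A at most once, so |A| ≤ r; conversely every C_i meets A,
-- for otherwise C_i ∪ {v₀} would be a clique on |C_i| + 1 vertices inside
-- C_0 ∪ ⋯ ∪ C_i.  Hence |A| = r.  Since A is independent and joined to all
-- other vertices, with R = G − A we have
--     n = r + |V(R)|,   e(G) = r·|V(R)| + e(R),   t(G) = r·e(R) + t(R),
-- and therefore g(G,P) = −t(R) ≤ 0.  If G is 3-partite, R is bipartite, so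
-- t(R) = 0.

open import Defs hiding (sym)
open import Data.Nat using (ℕ; zero; suc; _+_; _*_; _≤_; z≤n; s≤s)
open import Data.Nat.Properties
  using (+-assoc; +-suc; *-suc; +-identityʳ; ≤-trans; m≤n+m; ≤-reflexive; ≤-antisym)
open import Data.Nat.Tactic.RingSolver using (solve-∀)
open import Data.Bool using (Bool; true; false; if_then_else_; _∧_; _∨_; not)
open import Data.Bool.Properties using (∧-zeroʳ; ∨-identityʳ; ∨-zeroʳ; ∧-identityʳ; ∧-comm)
open import Data.Fin using (Fin; toℕ; _≟_)
import Data.Fin as F
open import Data.Fin.Properties
  using (any?; suc-injective; punchOut-injective; punchIn-punchOut; punchIn-injective; punchInᵢ≢i)
open import Data.Integer as ℤ using (ℤ; +_)
open import Data.Integer.Properties using (pos-+; pos-*; neg-≤-pos) renaming (≤-reflexive to ≤ᶻ-reflexive)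
import Data.Integer.Tactic.RingSolver as ℤ-Solver
open import Data.Product using (Σ; ∃; _×_; _,_; proj₁; proj₂)
open import Data.Sum using (_⊎_; inj₁; inj₂)
open import Data.Empty using (⊥; ⊥-elim)
open import Relation.Nullary using (Dec; yes; no; ¬_; ⌊_⌋)
open import Relation.Nullary.Decidable using (_×-dec_)
open import Relation.Binary.PropositionalEquality
open ≡-Reasoning

decided-true : ∀ {P : Set} (d : Dec P) → ⌊ d ⌋ ≡ true → P
decided-true (yes p) _ = p
decided-true (no _) ()

decided-false : ∀ {P : Set} (d : Dec P) → ⌊ d ⌋ ≡ false → ¬ P
decided-false (yes _) ()
decided-false (no ¬p) _ = ¬p

decide-true : ∀ {P : Set} (d : Dec P) → P → ⌊ d ⌋ ≡ true
decide-true (yes _) _ = refl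
decide-true (no ¬p) p = ⊥-elim (¬p p)

decide-false : ∀ {P : Set} (d : Dec P) → ¬ P → ⌊ d ⌋ ≡ false
decide-false (yes p) ¬p = ⊥-elim (¬p p)
decide-false (no _)  _  = refl

bool-cases : ∀ {P : Set} b → (b ≡ true → P) → (b ≡ false → P) → P
bool-cases true  t f = t refl
bool-cases false t f = f refl

true≢false : true ≢ false
true≢false ()

∨-cases : ∀ b c → b ∨ c ≡ true → b ≡ true ⊎ c ≡ true
∨-cases true  c _ = inj₁ refl
∨-cases false c e = inj₂ e

ind : Bool → ℕ
ind b = if b then 1 else 0

ind-guard : ∀ b {x y z} → ind x ≡ ind y + ind z → ind (b ∧ x) ≡ ind (b ∧ y) + ind (b ∧ z)
ind-guard false _ = refl
ind-guard true  h = h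

shift : ∀ {n} {P : Fin (suc n) → Set} → ((i : Fin (suc n)) → P i) → (i : Fin n) → P (F.suc i)
shift f i = f (F.suc i)

sumFin-cong : ∀ {n} {f g : Fin n → ℕ} → (∀ i → f i ≡ g i) → sumFin f ≡ sumFin g
sumFin-cong {zero}  h = refl
sumFin-cong {suc n} h = cong₂ _+_ (h F.zero) (sumFin-cong (shift h))

sumFin-zero : ∀ {n} → sumFin {n} (λ _ → 0) ≡ 0
sumFin-zero {zero}  = refl
sumFin-zero {suc n} = sumFin-zero {n}

sumFin-vanishes : ∀ {n} {f : Fin n → ℕ} → (∀ i → f i ≡ 0) → sumFin f ≡ 0
sumFin-vanishes {n} h = trans (sumFin-cong h) (sumFin-zero {n})

sumFin-+ : ∀ {n} (f g : Fin n → ℕ) → sumFin (λ i → f i + g i) ≡ sumFin f + sumFin g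
sumFin-+ {zero}  f g = refl
sumFin-+ {suc n} f g = trans
  (cong (λ s → f F.zero + g F.zero + s) (sumFin-+ (shift f) (shift g)))
  (interchange (f F.zero) (g F.zero) _ _)
  where
  interchange : ∀ p q r s → p + q + (r + s) ≡ p + r + (q + s)
  interchange = solve-∀

count-cong : ∀ {n} {f g : Fin n → Bool} → (∀ i → f i ≡ g i) → count f ≡ count g
count-cong h = sumFin-cong (λ i → cong ind (h i))

count-none : ∀ {n} {f : Fin n → Bool} → (∀ i → f i ≡ false) → count f ≡ 0
count-none h = sumFin-vanishes (λ i → cong ind (h i))

count-all : ∀ {n} → count {n} (λ _ → true) ≡ n
count-all {zero}  = refl
count-all {suc n} = cong suc (count-all {n})

count-head-true : ∀ {n} (f : Fin (suc n) → Bool) → f F.zero ≡ true →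
                  count f ≡ suc (count (shift f))
count-head-true f e rewrite e = refl

count-head-false : ∀ {n} (f : Fin (suc n) → Bool) → f F.zero ≡ false →
                   count f ≡ count (shift f)
count-head-false f e rewrite e = refl

count-split : ∀ {n} (a f : Fin n → Bool) →
              count f ≡ count (λ j → a j ∧ f j) + count (λ j → not (a j) ∧ f j)
count-split a f = trans (sumFin-cong (λ j → split (a j) (f j)))
                        (sumFin-+ (λ j → ind (a j ∧ f j)) (λ j → ind (not (a j) ∧ f j)))
  where
  split : ∀ b x → ind x ≡ ind (b ∧ x) + ind (not b ∧ x)
  split true  x = sym (+-identityʳ (ind x))
  split false x = refl

outside : ∀ {n} → (Fin n → Bool) → ℕ
outside a = count (λ v → not (a v))

count-complement : ∀ {n} (a : Fin n → Bool) → count a + outside a ≡ n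
count-complement {n} a = begin
  count a + outside a
    ≡⟨ sym (cong₂ _+_ (count-cong (λ j → ∧-identityʳ (a j))) (count-cong (λ j → ∧-identityʳ (not (a j))))) ⟩
  count (λ j → a j ∧ true) + count (λ j → not (a j) ∧ true)
    ≡⟨ sym (count-split a (λ _ → true)) ⟩
  count {n} (λ _ → true)
    ≡⟨ count-all ⟩
  n ∎

count-insert : ∀ {n} (f : Fin n → Bool) (v₀ : Fin n) → f v₀ ≡ false →
               count (λ v → f v ∨ ⌊ v ≟ v₀ ⌋) ≡ suc (count f)
count-insert {suc n} f F.zero e =
  trans (count-head-true (λ v → f v ∨ ⌊ v ≟ F.zero ⌋) (∨-zeroʳ (f F.zero)))
        (cong suc (trans (count-cong (λ v → ∨-identityʳ (f (F.suc v)))) (sym (count-head-false f e))))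
count-insert {suc n} f (F.suc w) e =
  trans (cong₂ _+_ (cong ind (∨-identityʳ (f F.zero)))
                   (trans (count-cong (λ v → cong (f (F.suc v) ∨_) (≟-suc v w)))
                          (count-insert (shift f) w e)))
        (+-suc (ind (f F.zero)) _)
  where
  ≟-suc : ∀ {m} (x y : Fin m) → ⌊ F.suc x ≟ F.suc y ⌋ ≡ ⌊ x ≟ y ⌋
  ≟-suc x y with x ≟ y
  ... | yes _ = refl
  ... | no _  = refl

-- A set that injects into Fin m has at most m elements.  Induction on n: a
-- first element of S is removed from the codomain with punchOut.
count-≤-injection : ∀ {n m} (S : Fin n → Bool) (f : (v : Fin n) → S v ≡ true → Fin m) →
                    (∀ u v su sv → f u su ≡ f v sv → u ≡ v) → count S ≤ m
count-≤-injection {zero} S f inj = z≤n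
count-≤-injection {suc n} {m} S f inj with S F.zero in s0
... | false = count-≤-injection (shift S) (λ v sv → f (F.suc v) sv)
                (λ u v su sv e → suc-injective (inj _ _ su sv e))
count-≤-injection {suc n} {zero} S f inj | true with f F.zero s0
... | ()
count-≤-injection {suc n} {suc m} S f inj | true =
  s≤s (count-≤-injection (shift S) f′
        (λ u v su sv e → suc-injective (inj _ _ su sv (punchOut-injective (avoid u su) (avoid v sv) e))))
  where
  avoid : ∀ v (sv : S (F.suc v) ≡ true) → f F.zero s0 ≢ f (F.suc v) sv
  avoid v sv eq with inj F.zero (F.suc v) s0 sv eq
  ... | ()
  f′ : (v : Fin n) → S (F.suc v) ≡ true → Fin m
  f′ v sv = F.punchOut (avoid v sv)

-- A set containing the injective image of Fin r has at least r elements.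
-- Induction on n: the preimage of vertex 0, if any, is removed with punchIn.
count-≥-injection : ∀ {n r} (S : Fin n → Bool) (g : Fin r → Fin n) →
                    (∀ i j → g i ≡ g j → i ≡ j) → (∀ i → S (g i) ≡ true) → r ≤ count S
count-≥-injection {zero} {zero} S g inj sg = z≤n
count-≥-injection {zero} {suc r} S g inj sg with g F.zero
... | ()
count-≥-injection {suc n} {r} S g inj sg with any? (λ i → g i ≟ F.zero)
... | no missed = ≤-trans (count-≥-injection (shift S) g′ inj′ sg′) (m≤n+m _ (ind (S F.zero)))
  where
  avoid : ∀ i → F.zero ≢ g i
  avoid i e = missed (i , sym e)
  g′ : Fin r → Fin n
  g′ i = F.punchOut (avoid i)
  inj′ : ∀ i j → g′ i ≡ g′ j → i ≡ j
  inj′ i j e = inj i j (punchOut-injective (avoid i) (avoid j) e)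
  sg′ : ∀ i → S (F.suc (g′ i)) ≡ true
  sg′ i = trans (cong S (punchIn-punchOut (avoid i))) (sg i)
count-≥-injection {suc n} {zero} S g inj sg | yes (() , _)
count-≥-injection {suc n} {suc r} S g inj sg | yes (i₀ , hit) =
  ≤-trans (s≤s (count-≥-injection (shift S) g′ inj′ sg′))
          (≤-reflexive (sym (count-head-true S (trans (cong S (sym hit)) (sg i₀)))))
  where
  avoid : ∀ j → F.zero ≢ g (F.punchIn i₀ j)
  avoid j e = punchInᵢ≢i i₀ j (inj _ _ (trans (sym e) (sym hit)))
  g′ : Fin r → Fin n
  g′ j = F.punchOut (avoid j)
  inj′ : ∀ i j → g′ i ≡ g′ j → i ≡ j
  inj′ i j e = punchIn-injective i₀ i j (inj _ _ (punchOut-injective (avoid i) (avoid j) e))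
  sg′ : ∀ i → S (F.suc (g′ i)) ≡ true
  sg′ i = trans (cong S (punchIn-punchOut (avoid i))) (sg _)

crossPairs : ∀ {n} → (Fin n → Bool) → (Fin n → Bool) → ℕ
crossPairs x d = sumFin (λ i → count λ j → (i <ᶠ j) ∧ ((x i ∧ d j) ∨ (d i ∧ x j)))

cross-pairs : ∀ {n} (x d : Fin n → Bool) → (∀ i → x i ∧ d i ≡ false) → crossPairs x d ≡ count x * count d
cross-pairs {zero} x d disj = refl
cross-pairs {suc n} x d disj with x F.zero in x₀ | d F.zero in d₀
... | true  | true  = ⊥-elim (true≢false (trans (sym (cong₂ _∧_ x₀ d₀)) (disj F.zero)))
... | true  | false = cong₂ _+_ (count-cong (λ j → ∨-identityʳ (shift d j))) (cross-pairs (shift x) (shift d) (shift disj))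
... | false | true  = trans (cong (λ s → count (shift x) + s) (cross-pairs (shift x) (shift d) (shift disj)))
                           (sym (*-suc (count (shift x)) (count (shift d))))
... | false | false = trans (cong (_+ crossPairs (shift x) (shift d)) (sumFin-zero {n}))
                           (cross-pairs (shift x) (shift d) (shift disj))

Adjacency : ℕ → Set
Adjacency n = Fin n → Fin n → Bool

edgeCount : ∀ {n} → Adjacency n → ℕ
edgeCount A = sumFin λ u → count λ v → (u <ᶠ v) ∧ A u v

triangleCount : ∀ {n} → Adjacency n → ℕ
triangleCount A = sumFin λ u → sumFin λ v → count λ w →
  (u <ᶠ v) ∧ (v <ᶠ w) ∧ A u v ∧ A v w ∧ A u w

tail : ∀ {n} → Adjacency (suc n) → Adjacency n
tail A i j = A (F.suc i) (F.suc j)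

degree₀ : ∀ {n} → Adjacency (suc n) → ℕ
degree₀ A = count λ j → A F.zero (F.suc j)

linked₀ : ∀ {n} → Adjacency (suc n) → ℕ
linked₀ A = sumFin λ i → count λ j →
  (i <ᶠ j) ∧ A F.zero (F.suc i) ∧ A (F.suc i) (F.suc j) ∧ A F.zero (F.suc j)

edgeCount-peel : ∀ {n} (A : Adjacency (suc n)) → edgeCount A ≡ degree₀ A + edgeCount (tail A)
edgeCount-peel A = refl

triangleCount-peel : ∀ {n} (A : Adjacency (suc n)) → triangleCount A ≡ linked₀ A + triangleCount (tail A)
triangleCount-peel {n} A rewrite sumFin-zero {n} =
  cong (λ s → linked₀ A + s) (sumFin-cong λ i → sumFin-cong λ j → cong (_+ triangles₃ i j) (cong ind (∧-zeroʳ (i <ᶠ j))))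
  where
  triangles₃ : Fin n → Fin n → ℕ
  triangles₃ i j = count λ w → (i <ᶠ j) ∧ (j <ᶠ w) ∧ tail A i j ∧ tail A j w ∧ tail A i w

record IndependentJoin {n : ℕ} (A : Adjacency n) (a : Fin n → Bool) : Set where
  field
    independent : ∀ u v → a u ≡ true → a v ≡ true → A u v ≡ false
    joined-out  : ∀ u v → a u ≡ true → a v ≡ false → A u v ≡ true
    joined-in   : ∀ u v → a u ≡ false → a v ≡ true → A u v ≡ true

-- The graph with the vertices of a deleted (kept as isolated vertices).
without : ∀ {n} → Adjacency n → (Fin n → Bool) → Adjacency n
without A a u v = not (a u) ∧ (not (a v) ∧ A u v)

without-edge : ∀ {n} (A : Adjacency n) (a : Fin n → Bool) u v → without A a u v ≡ true →
               a u ≡ false × a v ≡ false × A u v ≡ true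
without-edge A a u v e with a u | a v | A u v
... | false | false | true = refl , refl , refl

join-tail : ∀ {n} {A : Adjacency (suc n)} {a : Fin (suc n) → Bool} →
            IndependentJoin A a → IndependentJoin (tail A) (shift a)
join-tail J = record
  { independent = λ u v → independent (F.suc u) (F.suc v)
  ; joined-out  = λ u v → joined-out (F.suc u) (F.suc v)
  ; joined-in   = λ u v → joined-in (F.suc u) (F.suc v)
  }
  where open IndependentJoin J

-- The triangle through an outside vertex 0 and later vertices i < j is either
-- a mixed triangle (exactly one of i, j in the set) or a triangle of the graph
-- with the set deleted; here xᵢ, xⱼ record membership of i, j.
triangle-through-outside : ∀ (a₀ xᵢ xⱼ A₀ᵢ A₀ⱼ Aᵢⱼ : Bool) → a₀ ≡ false →
  (xᵢ ≡ true → A₀ᵢ ≡ true) → (xⱼ ≡ true → A₀ⱼ ≡ true) →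
  (xᵢ ≡ true → xⱼ ≡ true → Aᵢⱼ ≡ false) →
  (xᵢ ≡ true → xⱼ ≡ false → Aᵢⱼ ≡ true) → (xᵢ ≡ false → xⱼ ≡ true → Aᵢⱼ ≡ true) →
  ind (A₀ᵢ ∧ Aᵢⱼ ∧ A₀ⱼ) ≡
    ind ((xᵢ ∧ (not xⱼ ∧ A₀ⱼ)) ∨ ((not xᵢ ∧ A₀ᵢ) ∧ xⱼ)) +
    ind ((not a₀ ∧ (not xᵢ ∧ A₀ᵢ)) ∧ (not xᵢ ∧ (not xⱼ ∧ Aᵢⱼ)) ∧ (not a₀ ∧ (not xⱼ ∧ A₀ⱼ)))
triangle-through-outside false true true A₀ᵢ A₀ⱼ Aᵢⱼ refl i₀ j₀ indep _ _
  rewrite i₀ refl | j₀ refl | indep refl refl = refl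
triangle-through-outside false true false A₀ᵢ A₀ⱼ Aᵢⱼ refl i₀ _ _ out _
  rewrite i₀ refl | out refl refl | ∨-identityʳ A₀ⱼ = sym (+-identityʳ (ind A₀ⱼ))
triangle-through-outside false false true A₀ᵢ A₀ⱼ Aᵢⱼ refl _ j₀ _ _ inn
  rewrite j₀ refl | inn refl refl | ∧-zeroʳ A₀ᵢ = sym (+-identityʳ (ind (A₀ᵢ ∧ true)))
triangle-through-outside false false false A₀ᵢ A₀ⱼ Aᵢⱼ refl _ _ _ _ _
  rewrite ∧-zeroʳ A₀ᵢ = refl

module VertexZero {n : ℕ} {A : Adjacency (suc n)} {a : Fin (suc n) → Bool}
                  (J : IndependentJoin A a) where
  open IndependentJoin J

  a′ : Fin n → Bool
  a′ = shift a

  R : Adjacency (suc n)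
  R = without A a

  neighbour-inside : a F.zero ≡ true → ∀ j → A F.zero (F.suc j) ≡ not (a′ j)
  neighbour-inside a₀ j = bool-cases (a′ j)
    (λ e → trans (independent F.zero (F.suc j) a₀ e) (sym (cong not e)))
    (λ e → trans (joined-out F.zero (F.suc j) a₀ e) (sym (cong not e)))

  degree₀-inside : a F.zero ≡ true → degree₀ A ≡ outside a′
  degree₀-inside a₀ = count-cong (neighbour-inside a₀)

  degree₀-deleted : a F.zero ≡ true → degree₀ R ≡ 0
  degree₀-deleted a₀ = count-none λ j → cong (λ b → not b ∧ (not (a′ j) ∧ A F.zero (F.suc j))) a₀

  -- The neighbours of a vertex of a are the vertices of R, so the edges among
  -- them are the edges of R.
  linked₀-inside : a F.zero ≡ true → linked₀ A ≡ edgeCount (tail R)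
  linked₀-inside a₀ = sumFin-cong λ i → count-cong λ j →
    trans (cong₂ (λ p q → (i <ᶠ j) ∧ (p ∧ (A (F.suc i) (F.suc j) ∧ q))) (neighbour-inside a₀ i) (neighbour-inside a₀ j))
          (cong (λ t → (i <ᶠ j) ∧ (not (a′ i) ∧ t)) (∧-comm (A (F.suc i) (F.suc j)) (not (a′ j))))

  linked₀-deleted : a F.zero ≡ true → linked₀ R ≡ 0
  linked₀-deleted a₀ = sumFin-vanishes λ i → count-none λ j →
    trans (cong (λ b → (i <ᶠ j) ∧ ((not b ∧ (not (a′ i) ∧ A F.zero (F.suc i))) ∧
                          (tail R i j ∧ (not b ∧ (not (a′ j) ∧ A F.zero (F.suc j)))))) a₀)
          (∧-zeroʳ (i <ᶠ j))

  outerNeighbour : Fin n → Bool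
  outerNeighbour j = not (a′ j) ∧ A F.zero (F.suc j)

  degree₀-deleted-outside : a F.zero ≡ false → degree₀ R ≡ count outerNeighbour
  degree₀-deleted-outside a₀ = count-cong λ j → cong (λ b → not b ∧ outerNeighbour j) a₀

  -- A vertex outside a is adjacent to all of a and to its outer neighbours.
  degree₀-outside : a F.zero ≡ false → degree₀ A ≡ count a′ + degree₀ R
  degree₀-outside a₀ = begin
    degree₀ A                                            ≡⟨ count-split a′ (λ j → A F.zero (F.suc j)) ⟩
    count (λ j → a′ j ∧ A F.zero (F.suc j)) + count outerNeighbour
      ≡⟨ cong₂ _+_ (count-cong inner) (sym (degree₀-deleted-outside a₀)) ⟩
    count a′ + degree₀ R                                 ∎
    where
    inner : ∀ j → a′ j ∧ A F.zero (F.suc j) ≡ a′ j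
    inner j = bool-cases (a′ j)
      (λ e → trans (cong (_∧ A F.zero (F.suc j)) e) (trans (joined-in F.zero (F.suc j) a₀ e) (sym e)))
      (λ e → trans (cong (_∧ A F.zero (F.suc j)) e) (sym e))

  -- Triangles through a vertex 0 outside a: those meeting a once (a cross pair
  -- between a and the outer neighbours) and the triangles of R through 0.
  linked₀-outside : a F.zero ≡ false → linked₀ A ≡ count a′ * degree₀ R + linked₀ R
  linked₀-outside a₀ = begin
    linked₀ A
      ≡⟨ sumFin-cong (λ i → trans (sumFin-cong (split i)) (sumFin-+ (λ j → ind (cross i j)) (λ j → ind (deleted i j)))) ⟩
    sumFin (λ i → count (cross i) + count (deleted i))
      ≡⟨ sumFin-+ (λ i → count (cross i)) (λ i → count (deleted i)) ⟩
    crossPairs a′ outerNeighbour + linked₀ R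
      ≡⟨ cong (_+ linked₀ R) (cross-pairs a′ outerNeighbour disjoint) ⟩
    count a′ * count outerNeighbour + linked₀ R
      ≡⟨ cong (λ m → count a′ * m + linked₀ R) (sym (degree₀-deleted-outside a₀)) ⟩
    count a′ * degree₀ R + linked₀ R ∎
    where
    cross deleted : Fin n → Fin n → Bool
    cross i j = (i <ᶠ j) ∧ ((a′ i ∧ outerNeighbour j) ∨ (outerNeighbour i ∧ a′ j))
    deleted i j = (i <ᶠ j) ∧ R F.zero (F.suc i) ∧ R (F.suc i) (F.suc j) ∧ R F.zero (F.suc j)
    split : ∀ i j → ind ((i <ᶠ j) ∧ A F.zero (F.suc i) ∧ A (F.suc i) (F.suc j) ∧ A F.zero (F.suc j))
                    ≡ ind (cross i j) + ind (deleted i j)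
    split i j = ind-guard (i <ᶠ j) (triangle-through-outside (a F.zero) (a′ i) (a′ j)
      (A F.zero (F.suc i)) (A F.zero (F.suc j)) (A (F.suc i) (F.suc j)) a₀
      (joined-in F.zero (F.suc i) a₀) (joined-in F.zero (F.suc j) a₀)
      (independent (F.suc i) (F.suc j)) (joined-out (F.suc i) (F.suc j)) (joined-in (F.suc i) (F.suc j)))
    disjoint : ∀ i → a′ i ∧ outerNeighbour i ≡ false
    disjoint i with a′ i
    ... | true  = refl
    ... | false = refl

edges-join : ∀ {n} {A : Adjacency n} {a : Fin n → Bool} → IndependentJoin A a →
             edgeCount A ≡ count a * outside a + edgeCount (without A a)
edges-join {zero}  J = refl
edges-join {suc n} {A} {a} J = bool-cases (a F.zero) inside outside₀
  where
  open VertexZero J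
  IH : edgeCount (tail A) ≡ count a′ * outside a′ + edgeCount (tail R)
  IH = edges-join (join-tail J)
  rearrange : ∀ c d o e → (c + d) + (c * o + e) ≡ c * suc o + (d + e)
  rearrange = solve-∀
  inside : a F.zero ≡ true → edgeCount A ≡ count a * outside a + edgeCount R
  inside a₀ = begin
    edgeCount A                              ≡⟨ edgeCount-peel A ⟩
    degree₀ A + edgeCount (tail A)           ≡⟨ cong₂ _+_ (degree₀-inside a₀) IH ⟩
    outside a′ + (count a′ * outside a′ + edgeCount (tail R))
      ≡⟨ sym (+-assoc (outside a′) _ _) ⟩
    suc (count a′) * outside a′ + edgeCount (tail R)
      ≡⟨ cong₂ (λ c o → c * o + edgeCount (tail R)) (sym (count-head-true a a₀))
                                                     (sym (count-head-false (λ v → not (a v)) (cong not a₀))) ⟩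
    count a * outside a + (0 + edgeCount (tail R))
      ≡⟨ cong (λ d → count a * outside a + (d + edgeCount (tail R))) (sym (degree₀-deleted a₀)) ⟩
    count a * outside a + edgeCount R        ∎
  outside₀ : a F.zero ≡ false → edgeCount A ≡ count a * outside a + edgeCount R
  outside₀ a₀ = begin
    edgeCount A                              ≡⟨ edgeCount-peel A ⟩
    degree₀ A + edgeCount (tail A)           ≡⟨ cong₂ _+_ (degree₀-outside a₀) IH ⟩
    (count a′ + degree₀ R) + (count a′ * outside a′ + edgeCount (tail R))
      ≡⟨ rearrange (count a′) (degree₀ R) (outside a′) (edgeCount (tail R)) ⟩
    count a′ * suc (outside a′) + edgeCount R
      ≡⟨ cong₂ (λ c o → c * o + edgeCount R) (sym (count-head-false a a₀))
                                              (sym (count-head-true (λ v → not (a v)) (cong not a₀))) ⟩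
    count a * outside a + edgeCount R        ∎

triangles-join : ∀ {n} {A : Adjacency n} {a : Fin n → Bool} → IndependentJoin A a →
                 triangleCount A ≡ count a * edgeCount (without A a) + triangleCount (without A a)
triangles-join {zero}  J = refl
triangles-join {suc n} {A} {a} J = bool-cases (a F.zero) inside outside₀
  where
  open VertexZero J
  IH : triangleCount (tail A) ≡ count a′ * edgeCount (tail R) + triangleCount (tail R)
  IH = triangles-join (join-tail J)
  rearrange : ∀ c d l e t → (c * d + l) + (c * e + t) ≡ c * (d + e) + (l + t)
  rearrange = solve-∀
  inside : a F.zero ≡ true → triangleCount A ≡ count a * edgeCount R + triangleCount R
  inside a₀ = begin
    triangleCount A                          ≡⟨ triangleCount-peel A ⟩
    linked₀ A + triangleCount (tail A)       ≡⟨ cong₂ _+_ (linked₀-inside a₀) IH ⟩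
    edgeCount (tail R) + (count a′ * edgeCount (tail R) + triangleCount (tail R))
      ≡⟨ sym (+-assoc (edgeCount (tail R)) _ _) ⟩
    suc (count a′) * edgeCount (tail R) + triangleCount (tail R)
      ≡⟨ cong₂ (λ c e → c * e + triangleCount (tail R)) (sym (count-head-true a a₀))
                                                        (cong (_+ edgeCount (tail R)) (sym (degree₀-deleted a₀))) ⟩
    count a * edgeCount R + (0 + triangleCount (tail R))
      ≡⟨ cong (λ l → count a * edgeCount R + (l + triangleCount (tail R))) (sym (linked₀-deleted a₀)) ⟩
    count a * edgeCount R + (linked₀ R + triangleCount (tail R))
      ≡⟨ cong (λ t → count a * edgeCount R + t) (sym (triangleCount-peel R)) ⟩
    count a * edgeCount R + triangleCount R  ∎
  outside₀ : a F.zero ≡ false → triangleCount A ≡ count a * edgeCount R + triangleCount R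
  outside₀ a₀ = begin
    triangleCount A                          ≡⟨ triangleCount-peel A ⟩
    linked₀ A + triangleCount (tail A)       ≡⟨ cong₂ _+_ (linked₀-outside a₀) IH ⟩
    (count a′ * degree₀ R + linked₀ R) + (count a′ * edgeCount (tail R) + triangleCount (tail R))
      ≡⟨ rearrange (count a′) (degree₀ R) (linked₀ R) (edgeCount (tail R)) (triangleCount (tail R)) ⟩
    count a′ * edgeCount R + (linked₀ R + triangleCount (tail R))
      ≡⟨ cong₂ (λ c t → c * edgeCount R + t) (sym (count-head-false a a₀)) (sym (triangleCount-peel R)) ⟩
    count a * edgeCount R + triangleCount R  ∎

g-identity : ∀ {n e t} r c e′ t′ → n ≡ r + c → e ≡ r * c + e′ → t ≡ r * e′ + t′ →
             + r ℤ.* (+ e ℤ.- + r ℤ.* (+ n ℤ.- + r)) ℤ.- + t ≡ ℤ.- (+ t′)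
g-identity r c e′ t′ refl refl refl = begin
  + r ℤ.* (+ (r * c + e′) ℤ.- + r ℤ.* (+ (r + c) ℤ.- + r)) ℤ.- + (r * e′ + t′)
    ≡⟨ cong₂ (λ E T → + r ℤ.* (E ℤ.- + r ℤ.* (+ (r + c) ℤ.- + r)) ℤ.- T) (pos-bilinear r c e′) (pos-bilinear r e′ t′) ⟩
  + r ℤ.* ((+ r ℤ.* + c ℤ.+ + e′) ℤ.- + r ℤ.* (+ (r + c) ℤ.- + r)) ℤ.- (+ r ℤ.* + e′ ℤ.+ + t′)
    ≡⟨ cong (λ N → + r ℤ.* ((+ r ℤ.* + c ℤ.+ + e′) ℤ.- + r ℤ.* (N ℤ.- + r)) ℤ.- (+ r ℤ.* + e′ ℤ.+ + t′)) (pos-+ r c) ⟩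
  + r ℤ.* ((+ r ℤ.* + c ℤ.+ + e′) ℤ.- + r ℤ.* ((+ r ℤ.+ + c) ℤ.- + r)) ℤ.- (+ r ℤ.* + e′ ℤ.+ + t′)
    ≡⟨ ring (+ r) (+ c) (+ e′) (+ t′) ⟩
  ℤ.- (+ t′) ∎
  where
  ring : ∀ (R C E T : ℤ) → R ℤ.* ((R ℤ.* C ℤ.+ E) ℤ.- R ℤ.* ((R ℤ.+ C) ℤ.- R)) ℤ.- (R ℤ.* E ℤ.+ T) ≡ ℤ.- T
  ring = ℤ-Solver.solve-∀
  pos-bilinear : ∀ x y z → + (x * y + z) ≡ + x ℤ.* + y ℤ.+ + z
  pos-bilinear x y z = trans (pos-+ (x * y) z) (cong (ℤ._+ + z) (pos-* x y))

gval-join : ∀ {n} (G : Graph n) (a : Fin n → Bool) → IndependentJoin (Adj G) a →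
            gval G (count a) ≡ ℤ.- (+ triangleCount (without (Adj G) a))
gval-join G a J = g-identity (count a) (outside a) _ _
  (sym (count-complement a)) (edges-join J) (triangles-join J)

inPart : ∀ {n l} → (Fin n → Fin l) → Fin l → Fin n → Bool
inPart p k v = ⌊ p v ≟ k ⌋

part-join : ∀ {n l} {G : Graph n} {p : Fin n → Fin l} → IsCompleteMultipartite G l p →
            ∀ k → IndependentJoin (Adj G) (inPart p k)
part-join {G = G} {p} mp k = record
  { independent = λ u v u∈k v∈k → bool-cases (Adj G u v)
      (λ uv → ⊥-elim (proj₁ (mp u v) uv (trans (in-k u∈k) (sym (in-k v∈k))))) (λ uv → uv)
  ; joined-out  = λ u v u∈k v∉k → proj₂ (mp u v) (λ e → out-k v∉k (trans (sym e) (in-k u∈k)))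
  ; joined-in   = λ u v u∉k v∈k → proj₂ (mp u v) (λ e → out-k u∉k (trans e (in-k v∈k)))
  }
  where
  in-k : ∀ {v} → inPart p k v ≡ true → p v ≡ k
  in-k {v} = decided-true (p v ≟ k)
  out-k : ∀ {v} → inPart p k v ≡ false → p v ≢ k
  out-k {v} = decided-false (p v ≟ k)

-- A part meets each clique of a partition into cliques at most once.
part-≤-cliques : ∀ {n l r} {G : Graph n} {p : Fin n → Fin l} → IsCompleteMultipartite G l p →
                 GreedyPartition G r → ∀ k → count (inPart p k) ≤ r
part-≤-cliques {G = G} {p} mp P k = count-≤-injection (inPart p k) (λ v _ → cls v) injective
  where
  open GreedyPartition P
  injective : ∀ u v → inPart p k u ≡ true → inPart p k v ≡ true → cls u ≡ cls v → u ≡ v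
  injective u v u∈k v∈k same with u ≟ v
  ... | yes u≡v = u≡v
  ... | no  u≢v = ⊥-elim (true≢false (trans (sym (clique u v same u≢v))
                                            (IndependentJoin.independent (part-join {G = G} mp k) u v u∈k v∈k)))

-- For a greedy partition, the part of a vertex v₀ ∈ C_0 meets every clique,
-- hence has exactly r vertices.
module GreedyMultipartite {n l r : ℕ} {G : Graph n} {p : Fin n → Fin l}
                          (mp : IsCompleteMultipartite G l p) (P : GreedyPartition G (suc r)) where
  open GreedyPartition P

  v₀ : Fin n
  v₀ = proj₁ (nonempty F.zero)

  v₀∈C₀ : cls v₀ ≡ F.zero
  v₀∈C₀ = proj₂ (nonempty F.zero)

  k₀ : Fin l
  k₀ = p v₀

  -- If C_i (i ≥ 1) avoided the part k₀, then C_i ∪ {v₀} would be a clique on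
  -- |C_i| + 1 vertices inside C_0 ∪ ⋯ ∪ C_i.
  cannot-avoid : ∀ i → ¬ (∃ λ v → cls v ≡ i × p v ≡ k₀) → ⊥
  cannot-avoid F.zero avoids = avoids (v₀ , v₀∈C₀ , refl)
  cannot-avoid (F.suc i′) avoids = greedy i (s≤s z≤n) S within extended-clique enlarged
    where
    i = F.suc i′
    S : Fin n → Bool
    S v = ⌊ cls v ≟ i ⌋ ∨ ⌊ v ≟ v₀ ⌋
    within : ∀ v → S v ≡ true → toℕ (cls v) ≤ toℕ i
    within v v∈S with ∨-cases _ _ v∈S
    ... | inj₁ v∈Cᵢ = ≤-reflexive (cong toℕ (decided-true (cls v ≟ i) v∈Cᵢ))
    ... | inj₂ v≡v₀ = subst (λ c → toℕ c ≤ toℕ i)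
                            (sym (trans (cong cls (decided-true (v ≟ v₀) v≡v₀)) v₀∈C₀)) z≤n
    extended-clique : IsCliqueSet G S
    extended-clique u v u∈S v∈S u≢v with ∨-cases _ _ u∈S | ∨-cases _ _ v∈S
    ... | inj₁ u∈Cᵢ | inj₁ v∈Cᵢ =
      clique u v (trans (decided-true (cls u ≟ i) u∈Cᵢ) (sym (decided-true (cls v ≟ i) v∈Cᵢ))) u≢v
    ... | inj₁ u∈Cᵢ | inj₂ v≡v₀ = proj₂ (mp u v) λ same →
      avoids (u , decided-true (cls u ≟ i) u∈Cᵢ , trans same (cong p (decided-true (v ≟ v₀) v≡v₀)))
    ... | inj₂ u≡v₀ | inj₁ v∈Cᵢ = proj₂ (mp u v) λ same →
      avoids (v , decided-true (cls v ≟ i) v∈Cᵢ , trans (sym same) (cong p (decided-true (u ≟ v₀) u≡v₀)))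
    ... | inj₂ u≡v₀ | inj₂ v≡v₀ =
      ⊥-elim (u≢v (trans (decided-true (u ≟ v₀) u≡v₀) (sym (decided-true (v ≟ v₀) v≡v₀))))
    enlarged : count S ≡ suc (size i)
    enlarged = count-insert (λ v → ⌊ cls v ≟ i ⌋) v₀ (decide-false (cls v₀ ≟ i) λ v₀∈Cᵢ → 0≢i (trans (sym v₀∈C₀) v₀∈Cᵢ))
      where
      0≢i : F.zero ≢ i
      0≢i ()

  meets : ∀ i → Σ (Fin n) λ v → cls v ≡ i × p v ≡ k₀
  meets i with any? (λ v → (cls v ≟ i) ×-dec (p v ≟ k₀))
  ... | yes found  = found
  ... | no  avoids = ⊥-elim (cannot-avoid i avoids)

  part-size : count (inPart p k₀) ≡ suc r
  part-size = ≤-antisym (part-≤-cliques mp P k₀)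
    (count-≥-injection (inPart p k₀) (λ i → proj₁ (meets i)) injective
                       (λ i → decide-true (p (proj₁ (meets i)) ≟ k₀) (proj₂ (proj₂ (meets i)))))
    where
    injective : ∀ i j → proj₁ (meets i) ≡ proj₁ (meets j) → i ≡ j
    injective i j same = trans (sym (proj₁ (proj₂ (meets i)))) (trans (cong cls same) (proj₁ (proj₂ (meets j))))

gval-greedy : ∀ {n l r} {G : Graph n} {p : Fin n → Fin l} → IsCompleteMultipartite G l p →
              GreedyPartition G (suc r) →
              Σ (Fin l) λ k → gval G (suc r) ≡ ℤ.- (+ triangleCount (without (Adj G) (inPart p k)))
gval-greedy {G = G} {p} mp P =
  k₀ , subst (λ m → gval G m ≡ ℤ.- (+ triangleCount (without (Adj G) (inPart p k₀))))
             part-size (gval-join G (inPart p k₀) (part-join {G = G} mp k₀))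
  where open GreedyMultipartite mp P

-- A partition into no cliques only exists for the empty graph, where g = 0.
gval-empty : ∀ {n} (G : Graph n) → GreedyPartition G 0 → gval G 0 ≡ + 0
gval-empty {zero}  G P = refl
gval-empty {suc n} G P with GreedyPartition.cls P F.zero
... | ()

triangleCount-free : ∀ {n} (B : Adjacency n) →
  (∀ u v w → B u v ≡ true → B v w ≡ true → B u w ≡ true → ⊥) → triangleCount B ≡ 0
triangleCount-free B no-triangle =
  sumFin-vanishes λ u → sumFin-vanishes λ v → count-none λ w →
    not-all (u <ᶠ v) (v <ᶠ w) (B u v) (B v w) (B u w) (no-triangle u v w)
  where
  not-all : ∀ b c x y z → (x ≡ true → y ≡ true → z ≡ true → ⊥) → b ∧ c ∧ x ∧ y ∧ z ≡ false
  not-all false _     _     _     _     _ = refl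
  not-all true  false _     _     _     _ = refl
  not-all true  true  false _     _     _ = refl
  not-all true  true  true  false _     _ = refl
  not-all true  true  true  true  false _ = refl
  not-all true  true  true  true  true  h = ⊥-elim (h refl refl refl)

fin2-no-three : (x y z : Fin 2) → x ≢ y → y ≢ z → x ≢ z → ⊥
fin2-no-three F.zero           F.zero           _                x≢y _   _   = x≢y refl
fin2-no-three (F.suc F.zero)   (F.suc F.zero)   _                x≢y _   _   = x≢y refl
fin2-no-three F.zero           (F.suc F.zero)   F.zero           _   _   x≢z = x≢z refl
fin2-no-three F.zero           (F.suc F.zero)   (F.suc F.zero)   _   y≢z _   = y≢z refl
fin2-no-three (F.suc F.zero)   F.zero           F.zero           _   y≢z _   = y≢z refl
fin2-no-three (F.suc F.zero)   F.zero           (F.suc F.zero)   _   _   x≢z = x≢z refl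

fin3-no-three-avoiding : (k x y z : Fin 3) → k ≢ x → k ≢ y → k ≢ z → x ≢ y → y ≢ z → x ≢ z → ⊥
fin3-no-three-avoiding k x y z k≢x k≢y k≢z x≢y y≢z x≢z =
  fin2-no-three (F.punchOut k≢x) (F.punchOut k≢y) (F.punchOut k≢z)
    (λ e → x≢y (punchOut-injective k≢x k≢y e))
    (λ e → y≢z (punchOut-injective k≢y k≢z e))
    (λ e → x≢z (punchOut-injective k≢x k≢z e))

-- Deleting one part of a complete 3-partite graph leaves a bipartite, hence
-- triangle-free, graph.
tripartite-without-part : ∀ {n} {G : Graph n} {q : Fin n → Fin 3} → IsCompleteMultipartite G 3 q →
                          ∀ k → triangleCount (without (Adj G) (inPart q k)) ≡ 0
tripartite-without-part {G = G} {q} mp k = triangleCount-free _ λ u v w uv vw uw →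
  let (u∉k , v∉k , u~v) = without-edge (Adj G) (inPart q k) u v uv
      (_   , w∉k , v~w) = without-edge (Adj G) (inPart q k) v w vw
      (_   , _   , u~w) = without-edge (Adj G) (inPart q k) u w uw
  in fin3-no-three-avoiding k (q u) (q v) (q w)
       (avoids u∉k) (avoids v∉k) (avoids w∉k)
       (proj₁ (mp u v) u~v) (proj₁ (mp v w) v~w) (proj₁ (mp u w) u~w)
  where
  avoids : ∀ {v} → inPart q k v ≡ false → k ≢ q v
  avoids {v} v∉k = ≢-sym (decided-false (q v ≟ k) v∉k)

lemma3 : (∀ (n : ℕ) (G : Graph n) (l : ℕ) (p : Fin n → Fin l) →
             1 ≤ l → IsCompleteMultipartite G l p →
             ∀ (r : ℕ) → GreedyPartition G r → gval G r ℤ.≤ + 0)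
           × (∀ (n : ℕ) (G : Graph n) (q : Fin n → Fin 3) →
             IsCompleteMultipartite G 3 q →
             ∀ (r : ℕ) → GreedyPartition G r → gval G r ≡ + 0)
lemma3 = nonpositive , vanishes-when-tripartite
  where
  nonpositive : ∀ (n : ℕ) (G : Graph n) (l : ℕ) (p : Fin n → Fin l) →
                1 ≤ l → IsCompleteMultipartite G l p →
                ∀ (r : ℕ) → GreedyPartition G r → gval G r ℤ.≤ + 0
  nonpositive n G l p _ mp zero    P = ≤ᶻ-reflexive (gval-empty G P)
  nonpositive n G l p _ mp (suc r) P with gval-greedy {G = G} mp P
  ... | _ , g≡-t = subst (ℤ._≤ + 0) (sym g≡-t) neg-≤-pos

  vanishes-when-tripartite : ∀ (n : ℕ) (G : Graph n) (q : Fin n → Fin 3) →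
                             IsCompleteMultipartite G 3 q →
                             ∀ (r : ℕ) → GreedyPartition G r → gval G r ≡ + 0
  vanishes-when-tripartite n G q mp zero    P = gval-empty G P
  vanishes-when-tripartite n G q mp (suc r) P with gval-greedy {G = G} mp P
  ... | k , g≡-t = trans g≡-t (cong (λ t → ℤ.- (+ t)) (tripartite-without-part {G = G} mp k))
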